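{- Let $S\in\{0,1\}^\omega$. (1) If $\rho_{\mathrm{LZ}}(S)=1$, then $S$ is not LZ-deep. (2) If $\mathrm{Dim}_{\mathrm{FS}}(S)=0$, then $S$ is not LZ-deep.
   Context: The Lempel-Ziv 78 algorithm LZ parses $x\in\{0,1\}^*$ into phrases $x=x_1x_2\cdots x_n$, each phrase distinct from the earlier ones (except possibly the last), with $x_i=x_{l(i)}b_i$ for some $l(i)<i$ and $b_i\in\{0,1\}$ ($x_0=\lambda$), greedily taking each phrase as the shortest prefix of the remaining input not yet a phrase; its output is $\mathrm{LZ}(x)=c_{l(1)}b_1\cdots c_{l(n)}b_n$, where $c_i$ is a fixed prefix-free binary encoding of the dictionary pointer $i$. An FST $T=(Q,q_0,\delta,\nu)$ ($\delta:Q\times\{0,1\}\to Q$, $\nu:Q\times\{0,1\}\to\{0,1\}^*$, output $T(xb)=T(x)\nu(\widehat\delta(x),b)$) is information lossless (ILFST) if $x\mapsto (T(x),\widehat\delta(x))$ is injective. $\rho_{\mathrm{LZ}}(S)=\liminf_n|\mathrm{LZ}(S\upharpoonright n)|/n$, and $\mathrm{Dim}_{\mathrm{FS}}(S)=\inf_{T\in\mathrm{ILFST}}\limsup_n|T(S\upharpoonright n)|/n$. $S$ is LZ-deep if there is $\alpha>0$ such that for every ILFST $C$, $|C(S\upharpoonright n)|-|\mathrm{LZ}(S\upharpoonright n)|\ge\alpha n$ for all but finitely many $n$. -}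

module Defs where

open import Data.Bool using (Bool; true; false)
open import Data.Bool.Properties using () renaming (_≟_ to _≟B_)
open import Data.Nat as ℕ using (ℕ; zero; suc)
open import Data.Fin using (Fin)
open import Data.List using (List; []; _∷_; _++_; length; [_])
open import Data.List.Properties using (≡-dec)
open import Data.Integer using (ℤ; +_)
open import Data.Rational using (ℚ; _≤_; _<_; _+_; _-_; _*_; _/_; 0ℚ)
open import Data.Product using (Σ; _×_; ∃; _,_)
open import Relation.Nullary using (¬_; yes; no)
open import Relation.Binary.PropositionalEquality using (_≡_)

Seq : Set
Seq = ℕ → Bool

_↾_ : Seq → ℕ → List Bool
S ↾ zero  = []
S ↾ suc n = (S ↾ n) ++ [ S n ]

ℕtoℚ : ℕ → ℚ
ℕtoℚ n = (+ n) / 1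

_≟L_ : (x y : List Bool) → Relation.Nullary.Dec (x ≡ y)
_≟L_ = ≡-dec _≟B_

IsPrefix : List Bool → List Bool → Set
IsPrefix u v = ∃ λ w → u ++ w ≡ v

PrefixFree : (ℕ → List Bool) → Set
PrefixFree c = ∀ i j → IsPrefix (c i) (c j) → i ≡ j

-- position of a word in the dictionary (dictionary position i holds phrase x_i,
-- position 0 holds the empty phrase λ); 0 if absent (never used in that case)
indexOf : List Bool → List (List Bool) → ℕ
indexOf w []       = 0
indexOf w (v ∷ vs) with w ≟L v
... | yes _ = 0
... | no  _ = suc (indexOf w vs)

member : List Bool → List (List Bool) → Bool
member w []       = false
member w (v ∷ vs) with w ≟L v
... | yes _ = true
... | no  _ = member w vs

emit : (ℕ → List Bool) → List (List Bool) → List Bool → Bool → List Bool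
emit c dict p b = c (indexOf p dict) ++ [ b ]

-- final (possibly repeated) phrase: cur = p b ; output c_{l(n)} b
flush : (ℕ → List Bool) → List (List Bool) → List Bool → List Bool
flush c dict []       = []
flush c dict (b ∷ bs) = go [] b bs
  where
  go : List Bool → Bool → List Bool → List Bool
  go p b []        = emit c dict p b
  go p b (b' ∷ bs) = go (p ++ [ b ]) b' bs

-- greedy parse: dict = dictionary (x_0 = λ, x_1, …), cur = current partial phrase
lzGo : (ℕ → List Bool) → List (List Bool) → List Bool → List Bool → List Bool
lzGo c dict cur []      = flush c dict cur
lzGo c dict cur (b ∷ x) with member (cur ++ [ b ]) dict
... | true  = lzGo c dict (cur ++ [ b ]) x
... | false = emit c dict cur b ++ lzGo c (dict ++ [ cur ++ [ b ] ]) [] x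

-- LZ(x) = c_{l(1)} b_1 ⋯ c_{l(n)} b_n, relative to the pointer code c
LZ : (ℕ → List Bool) → List Bool → List Bool
LZ c x = lzGo c ([] ∷ []) [] x

record FST : Set where
  field
    k  : ℕ
    q₀ : Fin k
    δ  : Fin k → Bool → Fin k
    ν  : Fin k → Bool → List Bool

module _ (T : FST) where
  open FST T

  δ̂-from : Fin k → List Bool → Fin k
  δ̂-from q []      = q
  δ̂-from q (b ∷ x) = δ̂-from (δ q b) x

  out-from : Fin k → List Bool → List Bool
  out-from q []      = []
  out-from q (b ∷ x) = ν q b ++ out-from (δ q b) x

  δ̂ : List Bool → Fin k
  δ̂ = δ̂-from q₀

  run : List Bool → List Bool
  run = out-from q₀

IsILFST : FST → Set
IsILFST T = ∀ x y → run T x ≡ run T y → δ̂ T x ≡ δ̂ T y → x ≡ y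

LiminfRatio≥ : (ℕ → ℕ) → ℚ → Set
LiminfRatio≥ a r = ∀ ε → 0ℚ < ε →
  ∃ λ N → ∀ n → N ℕ.≤ n → (r - ε) * ℕtoℚ n ≤ ℕtoℚ (a n)

LiminfRatio≤ : (ℕ → ℕ) → ℚ → Set
LiminfRatio≤ a r = ∀ ε → 0ℚ < ε →
  ∀ N → ∃ λ n → N ℕ.≤ n × ℕtoℚ (a n) ≤ (r + ε) * ℕtoℚ n

LiminfRatio≡ : (ℕ → ℕ) → ℚ → Set
LiminfRatio≡ a r = LiminfRatio≥ a r × LiminfRatio≤ a r

LimsupRatio≤ : (ℕ → ℕ) → ℚ → Set
LimsupRatio≤ a r = ∀ ε → 0ℚ < ε →
  ∃ λ N → ∀ n → N ℕ.≤ n → ℕtoℚ (a n) ≤ (r + ε) * ℕtoℚ n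

ρLZ≡1 : (ℕ → List Bool) → Seq → Set
ρLZ≡1 c S = LiminfRatio≡ (λ n → length (LZ c (S ↾ n))) (ℕtoℚ 1)

-- Dim_FS(S) = 0, i.e. inf over ILFSTs T of limsup |T(S↾n)|/n is 0
-- (all these limsups are ≥ 0, so the infimum is 0 iff each ε > 0 bounds one)
DimFS≡0 : Seq → Set
DimFS≡0 S = ∀ ε → 0ℚ < ε →
  Σ FST λ T → IsILFST T × LimsupRatio≤ (λ n → length (run T (S ↾ n))) ε

LZDeep : (ℕ → List Bool) → Seq → Set
LZDeep c S = ∃ λ α → 0ℚ < α × (∀ (C : FST) → IsILFST C →
  ∃ λ N → ∀ n → N ℕ.≤ n →
    α * ℕtoℚ n ≤ ℕtoℚ (length (run C (S ↾ n))) - ℕtoℚ (length (LZ c (S ↾ n))))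

-- Compressing S with the identity transducer costs exactly n bits, so if LZ
-- compresses S ↾ n to (1 - o(1)) n bits, the advantage of the identity
-- transducer over LZ is only o(n).  If Dim_FS(S) = 0, some ILFST compresses
-- S ↾ n to o(n) bits, and its advantage over LZ is at most that.  Either way
-- the linear advantage α n demanded by LZ-depth eventually fails.
module Submission where

open import Defs
open import Data.Bool using (Bool)
open import Data.Nat as ℕ using (ℕ; suc)
import Data.Nat.Properties as ℕ
open import Data.Fin using (zero)
open import Data.List using (List; []; _∷_; length)
open import Data.List.Properties using (length-++)
open import Data.Integer using (+_; +<+)
open import Data.Product using (Σ; ∃; _×_; _,_)
open import Data.Empty using (⊥)
open import Data.Rational
  using (ℚ; _≤_; _<_; _+_; _-_; _*_; _/_; 0ℚ; 1ℚ; ½; Positive; positive; *<*)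
open import Data.Rational.Properties
open import Data.Rational.Solver using (module +-*-Solver)
open import Relation.Nullary using (¬_)
open import Relation.Binary.PropositionalEquality
  using (_≡_; refl; sym; trans; cong; subst)

open +-*-Solver

Eventually : (ℕ → Set) → Set
Eventually P = ∃ λ N → ∀ n → N ℕ.≤ n → P n

module _ {P Q : ℕ → Set} where

  eventually-map : (∀ n → P n → Q n) → Eventually P → Eventually Q
  eventually-map f (N , p) = N , λ n N≤n → f n (p n N≤n)

  eventually-× : Eventually P → Eventually Q → Eventually (λ n → P n × Q n)
  eventually-× (M , p) (N , q) =
    M ℕ.+ N , λ n M+N≤n → p n (ℕ.m+n≤o⇒m≤o M M+N≤n) , q n (ℕ.m+n≤o⇒n≤o M M+N≤n)

eventually⇒positive-witness : ∀ {P : ℕ → Set} → Eventually P → ∃ λ m → P (suc m)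
eventually⇒positive-witness (N , p) = N , p (suc N) (ℕ.n≤1+n N)

ℕtoℚ-nonNeg : ∀ n → 0ℚ ≤ ℕtoℚ n
ℕtoℚ-nonNeg n = nonNegative⁻¹ (ℕtoℚ n) {{normalize-nonNeg n 1}}

ℕtoℚ-suc-pos : ∀ m → Positive (ℕtoℚ (suc m))
ℕtoℚ-suc-pos m = normalize-pos (suc m) 1

pos*pos⇒>0 : ∀ {p} → 0ℚ < p → ∀ q .{{_ : Positive q}} → 0ℚ < p * q
pos*pos⇒>0 {p} 0<p q = positive⁻¹ (p * q) {{pos*pos⇒pos p {{positive 0<p}} q}}

p*½<p : ∀ {p} → 0ℚ < p → p * ½ < p
p*½<p {p} 0<p = subst (p * ½ <_) (*-identityʳ p) (*-monoʳ-<-pos p {{positive 0<p}} ½<1)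
  where
  ½<1 : ½ < 1ℚ
  ½<1 = *<* (+<+ (ℕ.s≤s (ℕ.s≤s ℕ.z≤n)))

¼ : ℚ
¼ = + 1 / 4

p*¼+p*¼≡p*½ : ∀ p → p * ¼ + p * ¼ ≡ p * ½
p*¼+p*¼≡p*½ p = sym (*-distribˡ-+ p ¼ ¼)

module _ where
  open ≤-Reasoning

  p-q≤p : ∀ p {q} → 0ℚ ≤ q → p - q ≤ p
  p-q≤p p {q} 0≤q = begin
    p - q         ≡⟨ sym (+-identityʳ (p - q)) ⟩
    p - q + 0ℚ    ≤⟨ +-monoʳ-≤ (p - q) 0≤q ⟩
    p - q + q     ≡⟨ solve 2 (λ p q → p :- q :+ q := p) refl p q ⟩
    p             ∎

  [1-e]n≤m⇒n-m≤en : ∀ e n {m} → (1ℚ - e) * n ≤ m → n - m ≤ e * n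
  [1-e]n≤m⇒n-m≤en e n {m} [1-e]n≤m = begin
    n - m              ≤⟨ +-monoʳ-≤ n (neg-antimono-≤ [1-e]n≤m) ⟩
    n - (1ℚ - e) * n   ≡⟨ solve 2 (λ e n → n :- (con 1ℚ :- e) :* n := e :* n) refl e n ⟩
    e * n              ∎

linear-bounds-contradict : ∀ {a b} → a < b → (f : ℕ → ℚ) →
  Eventually (λ n → b * ℕtoℚ n ≤ f n) → Eventually (λ n → f n ≤ a * ℕtoℚ n) → ⊥
linear-bounds-contradict {a} {b} a<b f lower upper
  with eventually⇒positive-witness (eventually-× lower upper)
... | m , bn≤f , f≤an =
  <-irrefl refl (<-≤-trans (*-monoˡ-<-pos (ℕtoℚ (suc m)) {{ℕtoℚ-suc-pos m}} a<b)
                           (≤-trans bn≤f f≤an))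

length-↾ : ∀ (S : Seq) n → length (S ↾ n) ≡ n
length-↾ S ℕ.zero  = refl
length-↾ S (suc n) =
  trans (length-++ (S ↾ n)) (trans (cong (ℕ._+ 1) (length-↾ S n)) (ℕ.+-comm n 1))

identityFST : FST
identityFST = record { k = 1 ; q₀ = zero ; δ = λ _ _ → zero ; ν = λ _ b → b ∷ [] }

run-identityFST : ∀ x → run identityFST x ≡ x
run-identityFST []      = refl
run-identityFST (b ∷ x) = cong (b ∷_) (run-identityFST x)

identityFST-isILFST : IsILFST identityFST
identityFST-isILFST x y Tx≡Ty _ =
  trans (sym (run-identityFST x)) (trans Tx≡Ty (run-identityFST y))

module _ (c : ℕ → List Bool) (S : Seq) where

  LZ-length : ℕ → ℚ
  LZ-length n = ℕtoℚ (length (LZ c (S ↾ n)))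

  LZ-advantage : FST → ℕ → ℚ
  LZ-advantage C n = ℕtoℚ (length (run C (S ↾ n))) - LZ-length n

  ¬LZDeep-if-advantage-sublinear :
    (∀ α → 0ℚ < α → Σ FST λ C → IsILFST C ×
        Eventually (λ n → LZ-advantage C n ≤ (α * ½) * ℕtoℚ n)) →
    ¬ LZDeep c S
  ¬LZDeep-if-advantage-sublinear sublinear (α , 0<α , deep)
    with sublinear α 0<α
  ... | C , C-IL , upper =
    linear-bounds-contradict (p*½<p 0<α) (LZ-advantage C) (deep C C-IL) upper

  identity-advantage≤ : ∀ e n → (1ℚ - e) * ℕtoℚ n ≤ LZ-length n →
    LZ-advantage identityFST n ≤ e * ℕtoℚ n
  identity-advantage≤ e n
    rewrite run-identityFST (S ↾ n) | length-↾ S n = [1-e]n≤m⇒n-m≤en e (ℕtoℚ n)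

  advantage≤output : ∀ C n → LZ-advantage C n ≤ ℕtoℚ (length (run C (S ↾ n)))
  advantage≤output C n = p-q≤p _ (ℕtoℚ-nonNeg (length (LZ c (S ↾ n))))

  ρLZ≡1⇒¬LZDeep : ρLZ≡1 c S → ¬ LZDeep c S
  ρLZ≡1⇒¬LZDeep (ρ≥1 , _) = ¬LZDeep-if-advantage-sublinear λ α 0<α →
    identityFST , identityFST-isILFST ,
    eventually-map (identity-advantage≤ (α * ½)) (ρ≥1 (α * ½) (pos*pos⇒>0 0<α ½))

  -- The dimension bound ε and the limsup slack ε' are both taken to be α/4.
  DimFS≡0⇒¬LZDeep : DimFS≡0 S → ¬ LZDeep c S
  DimFS≡0⇒¬LZDeep dim = ¬LZDeep-if-advantage-sublinear λ α 0<α →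
    let (C , C-IL , C-output≤) = dim (α * ¼) (pos*pos⇒>0 0<α ¼)
        advantage≤ : ∀ n → ℕtoℚ (length (run C (S ↾ n))) ≤ (α * ¼ + α * ¼) * ℕtoℚ n →
                     LZ-advantage C n ≤ (α * ½) * ℕtoℚ n
        advantage≤ n output≤ = ≤-trans (advantage≤output C n)
          (subst (λ e → ℕtoℚ (length (run C (S ↾ n))) ≤ e * ℕtoℚ n) (p*¼+p*¼≡p*½ α) output≤)
    in C , C-IL , eventually-map advantage≤ (C-output≤ (α * ¼) (pos*pos⇒>0 0<α ¼))

theorem6 : (c : ℕ → List Bool) → PrefixFree c → (S : Seq) →
    (ρLZ≡1 c S → ¬ LZDeep c S) × (DimFS≡0 S → ¬ LZDeep c S)
theorem6 c _ S = ρLZ≡1⇒¬LZDeep c S , DimFS≡0⇒¬LZDeep c S
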